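{- For any Routley IM, any state $s$ of it, and all $L$-formulas $\alpha,\beta$: $s\Vdash\neg\alpha\vee\neg\beta$ iff $s\Vdash\neg\alpha$ or $s\Vdash\neg\beta$.
   Context: Let $L$ be the set of formulas built from a set $At$ of atomic formulas with $\wedge,\vee,\neg$. A Routley IF is a structure $\langle S,\circ,*,i,e\rangle$ where $S$ is a nonempty set, $\circ$ is an associative, commutative, idempotent binary operation on $S$, $*:S\to S$, and $i\neq e$ are elements of $S$ such that: $s\circ i=s$ and $s\circ e=e$ for all $s$; if $e=t\circ u$ then $e=t$ or $e=u$; and, writing $s\le t$ iff $s\circ t=s$: $i^*=e$ and $e^*=i$; $t\le u$ implies $u^*\le t^*$; for all $t,u$, $(t\circ u)^*\le t^*$ or $(t\circ u)^*\le u^*$. A proper filter is $F\subseteq S$ with $i\in F$, $e\notin F$, and $t\circ u\in F$ iff $t\in F$ and $u\in F$. A Routley IM is a Routley IF with a valuation $V$ assigning a proper filter to each atom. Support: $s\Vdash p$ iff $s\in V(p)$; $s\Vdash\alpha\wedge\beta$ iff $s\Vdash\alpha$ and $s\Vdash\beta$; $s\Vdash\alpha\vee\beta$ iff there are $t,u$ with $t\Vdash\alpha$, $u\Vdash\beta$, $t\circ u\le s$; $s\Vdash\neg\alpha$ iff $s^*\nVdash\alpha$. -}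

module Defs where

open import Level using (0ℓ)
open import Data.Product using (Σ; ∃; ∃-syntax; _×_; _,_)
open import Data.Sum using (_⊎_)
open import Relation.Nullary using (¬_)
open import Relation.Binary.PropositionalEquality using (_≡_)

data Formula (At : Set) : Set where
  atom : At → Formula At
  _∧′_ : Formula At → Formula At → Formula At
  _∨′_ : Formula At → Formula At → Formula At
  ¬′_  : Formula At → Formula At

record RoutleyIF : Set₁ where
  field
    S     : Set
    _∘_   : S → S → S
    _*    : S → S
    i     : S
    e     : S
    ∘-assoc : ∀ s t u → (s ∘ t) ∘ u ≡ s ∘ (t ∘ u)
    ∘-comm  : ∀ s t → s ∘ t ≡ t ∘ s
    ∘-idem  : ∀ s → s ∘ s ≡ s
    i≢e     : ¬ (i ≡ e)
    ∘-i     : ∀ s → s ∘ i ≡ s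
    ∘-e     : ∀ s → s ∘ e ≡ e
    e-prime : ∀ t u → e ≡ t ∘ u → (e ≡ t) ⊎ (e ≡ u)

  _≤_ : S → S → Set
  s ≤ t = s ∘ t ≡ s

  field
    i*≡e    : i * ≡ e
    e*≡i    : e * ≡ i
    *-anti  : ∀ t u → t ≤ u → (u *) ≤ (t *)
    *-split : ∀ t u → (((t ∘ u) *) ≤ (t *)) ⊎ (((t ∘ u) *) ≤ (u *))

  record ProperFilter : Set₁ where
    field
      F      : S → Set
      i∈F    : F i
      e∉F    : ¬ F e
      ∘∈F⇒   : ∀ t u → F (t ∘ u) → F t × F u
      ∘∈F⇐   : ∀ t u → F t → F u → F (t ∘ u)

record RoutleyIM (At : Set) : Set₁ where
  field
    frame : RoutleyIF
  open RoutleyIF frame public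
  field
    V : At → ProperFilter

  _⊩_ : S → Formula At → Set
  s ⊩ atom p    = ProperFilter.F (V p) s
  s ⊩ (α ∧′ β)  = (s ⊩ α) × (s ⊩ β)
  s ⊩ (α ∨′ β)  = ∃[ t ] ∃[ u ] ((t ⊩ α) × (u ⊩ β) × ((t ∘ u) ≤ s))
  s ⊩ (¬′ α)    = ¬ ((s *) ⊩ α)

-- Support is persistent along ≤, and the top state i supports every formula.
-- So a negation supported by s is joined with i to witness the disjunction.
-- Conversely, if t ⊩ ¬α, u ⊩ ¬β and t ∘ u ≤ s, then s* ≤ (t ∘ u)*, which lies
-- below t* or u*; persistence then transfers any support of α (or β) at s*
-- to t* (or u*), contradicting t ⊩ ¬α (or u ⊩ ¬β).
module Submission where

open import Defs
open import Data.Product using (_×_; _,_; proj₂)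
open import Data.Sum using (_⊎_; inj₁; inj₂; [_,_])
open import Data.Empty using (⊥)
open import Relation.Binary.PropositionalEquality using (sym; trans; cong; subst; module ≡-Reasoning)

module RoutleyIFProperties (F : RoutleyIF) where
  open RoutleyIF F

  ≤-refl : ∀ s → s ≤ s
  ≤-refl = ∘-idem

  ≤-trans : ∀ a b c → a ≤ b → b ≤ c → a ≤ c
  ≤-trans a b c a≤b b≤c = begin
      a ∘ c          ≡⟨ cong (_∘ c) (sym a≤b) ⟩
      (a ∘ b) ∘ c    ≡⟨ ∘-assoc a b c ⟩
      a ∘ (b ∘ c)    ≡⟨ cong (a ∘_) b≤c ⟩
      a ∘ b          ≡⟨ a≤b ⟩
      a              ∎
    where open ≡-Reasoning

  ∘-identityʳ-≤ : ∀ s → (s ∘ i) ≤ s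
  ∘-identityʳ-≤ s rewrite ∘-i s = ≤-refl s

  ∘-identityˡ-≤ : ∀ s → (i ∘ s) ≤ s
  ∘-identityˡ-≤ s rewrite ∘-comm i s | ∘-i s = ≤-refl s

  ≤-∘-split* : ∀ s t u → (t ∘ u) ≤ s → ((s *) ≤ (t *)) ⊎ ((s *) ≤ (u *))
  ≤-∘-split* s t u tu≤s with *-split t u
  ... | inj₁ l = inj₁ (≤-trans (s *) ((t ∘ u) *) (t *) (*-anti (t ∘ u) s tu≤s) l)
  ... | inj₂ l = inj₂ (≤-trans (s *) ((t ∘ u) *) (u *) (*-anti (t ∘ u) s tu≤s) l)

module RoutleyIMProperties {At : Set} (M : RoutleyIM At) where
  open RoutleyIM M
  open RoutleyIFProperties frame

  ⊩-persistent : ∀ (φ : Formula At) s t → s ≤ t → s ⊩ φ → t ⊩ φ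
  ⊩-persistent (atom p) s t s≤t h =
    proj₂ (ProperFilter.∘∈F⇒ (V p) s t (subst (ProperFilter.F (V p)) (sym s≤t) h))
  ⊩-persistent (φ ∧′ ψ) s t s≤t (hφ , hψ) =
    ⊩-persistent φ s t s≤t hφ , ⊩-persistent ψ s t s≤t hψ
  ⊩-persistent (φ ∨′ ψ) s t s≤t (x , y , hφ , hψ , xy≤s) =
    x , y , hφ , hψ , ≤-trans (x ∘ y) s t xy≤s s≤t
  ⊩-persistent (¬′ φ) s t s≤t h h* =
    h (⊩-persistent φ (t *) (s *) (*-anti s t s≤t) h*)

  mutual
    i⊩ : ∀ (φ : Formula At) → i ⊩ φ
    i⊩ (atom p) = ProperFilter.i∈F (V p)
    i⊩ (φ ∧′ ψ) = i⊩ φ , i⊩ ψ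
    i⊩ (φ ∨′ ψ) = i , i , i⊩ φ , i⊩ ψ , ∘-identityʳ-≤ i
    i⊩ (¬′ φ) h = e⊮ φ (subst (_⊩ φ) i*≡e h)

    e⊮ : ∀ (φ : Formula At) → e ⊩ φ → ⊥
    e⊮ (atom p) h = ProperFilter.e∉F (V p) h
    e⊮ (φ ∧′ ψ) (hφ , _) = e⊮ φ hφ
    e⊮ (φ ∨′ ψ) (x , y , hφ , hψ , xy≤e) with e-prime x y (trans (sym (∘-e (x ∘ y))) xy≤e)
    ... | inj₁ e≡x = e⊮ φ (subst (_⊩ φ) (sym e≡x) hφ)
    ... | inj₂ e≡y = e⊮ ψ (subst (_⊩ ψ) (sym e≡y) hψ)
    e⊮ (¬′ φ) h = h (subst (_⊩ φ) (sym e*≡i) (i⊩ φ))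

  ⊩-∨-introˡ : ∀ s (φ ψ : Formula At) → s ⊩ φ → s ⊩ (φ ∨′ ψ)
  ⊩-∨-introˡ s φ ψ h = s , i , h , i⊩ ψ , ∘-identityʳ-≤ s

  ⊩-∨-introʳ : ∀ s (φ ψ : Formula At) → s ⊩ ψ → s ⊩ (φ ∨′ ψ)
  ⊩-∨-introʳ s φ ψ h = i , s , i⊩ φ , h , ∘-identityˡ-≤ s

  ⊩-¬∨¬-elim : ∀ s (α β : Formula At) →
    s ⊩ ((¬′ α) ∨′ (¬′ β)) → (s ⊩ (¬′ α)) ⊎ (s ⊩ (¬′ β))
  ⊩-¬∨¬-elim s α β (t , u , t⊩¬α , u⊩¬β , tu≤s) with ≤-∘-split* s t u tu≤s
  ... | inj₁ s*≤t* = inj₁ λ s*⊩α → t⊩¬α (⊩-persistent α (s *) (t *) s*≤t* s*⊩α)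
  ... | inj₂ s*≤u* = inj₂ λ s*⊩β → u⊩¬β (⊩-persistent β (s *) (u *) s*≤u* s*⊩β)

proposition2 : {At : Set} (M : RoutleyIM At) → let open RoutleyIM M in
    (s : S) (α β : Formula At) →
      ((s ⊩ ((¬′ α) ∨′ (¬′ β))) → ((s ⊩ (¬′ α)) ⊎ (s ⊩ (¬′ β))))
      × (((s ⊩ (¬′ α)) ⊎ (s ⊩ (¬′ β))) → (s ⊩ ((¬′ α) ∨′ (¬′ β))))
proposition2 M s α β =
    ⊩-¬∨¬-elim s α β , [ ⊩-∨-introˡ s (¬′ α) (¬′ β) , ⊩-∨-introʳ s (¬′ α) (¬′ β) ]
  where open RoutleyIMProperties M
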